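{- For every HyperLTL sentence $\varphi$ there is a HyperFO sentence $\varphi'$ such that for every set $T\subseteq(2^{AP})^\omega$ of traces: $T\models\varphi$ if and only if $\mathcal{M}(T)\models\varphi'$.
   Context: Fix a finite set $AP$ of atomic propositions. A trace over $AP$ is a map $t:\mathbb{N}\to 2^{AP}$. HyperLTL formulas are given by the grammar $\varphi ::= \exists \pi.\ \varphi \mid \forall \pi.\ \varphi \mid \psi$ and $\psi ::= a_\pi \mid \neg\psi \mid \psi\vee\psi \mid \mathbf{X}\psi \mid \psi\,\mathbf{U}\,\psi$, where $a\in AP$ and $\pi$ ranges over a countable set of trace variables. For a set $T$ of traces and a trace assignment $\Pi$ (a partial map from trace variables to traces), with $\Pi[j]$ mapping each $\pi$ in the domain of $\Pi$ to the suffix $\Pi(\pi)(j)\Pi(\pi)(j+1)\cdots$: $(T,\Pi)\models a_\pi$ iff $a\in\Pi(\pi)(0)$; negation and disjunction as usual; $(T,\Pi)\models\mathbf{X}\psi$ iff $(T,\Pi[1])\models\psi$; $(T,\Pi)\models\psi_1\mathbf{U}\psi_2$ iff there is $j\ge0$ with $(T,\Pi[j])\models\psi_2$ and $(T,\Pi[j'])\models\psi_1$ for all $0\le j'<j$; $(T,\Pi)\models\exists\pi.\varphi$ iff some $t\in T$ has $(T,\Pi[\pi\mapsto t])\models\varphi$; $(T,\Pi)\models\forall\pi.\varphi$ iff all $t\in T$ do. A sentence has no free trace variables; $T\models\varphi$ means $(T,\Pi_\emptyset)\models\varphi$ for the empty assignment. For a set $T$ of traces, $\mathcal{M}(T)$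 is the relational structure with domain $T\times\mathbb{N}$, $<$ interpreted as $\{((t,n),(t,n')) : t\in T,\ n<n'\}$, the binary equal-level relation $E$ interpreted as $\{((t,n),(t',n)) : t,t'\in T,\ n\in\mathbb{N}\}$, and for each $a\in AP$ a unary $P_a$ interpreted as $\{(t,n): a\in t(n)\}$. FO$[<,E]$ is first-order logic with equality over $\{<,E\}\cup\{P_a: a\in AP\}$. Abbreviations: $x\le y$ is $x<y\vee x=y$; $\mathrm{succ}(x,y)$ is $x<y\wedge\neg\exists z.\ x<z<y$; $\min(x)$ is $\neg\exists y.\ \mathrm{succ}(y,x)$; $\exists^M x.\ \varphi$ is $\exists x.\ \min(x)\wedge\varphi$ and $\forall^M x.\ \varphi$ is $\forall x.\ \min(x)\rightarrow\varphi$; $\exists^G y\ge x.\ \varphi$ is $\exists y.\ y\ge x\wedge\varphi$ and $\forall^G y\ge x.\ \varphi$ is $\forall y.\ y\ge x\rightarrow\varphi$. HyperFO is the set of FO$[<,E]$ sentences of the form $Q_1^M x_1.\cdots Q_k^M x_k.\ Q_1^G y_1\ge x_{g_1}.\cdots Q_\ell^G y_\ell\ge x_{g_\ell}.\ \psi$ with each $Q\in\{\exists,\forall\}$, where $\{x_1,\dots,x_k\}$ and $\{y_1,\dots,y_\ell\}$ are disjoint sets of variables, each guard $x_{g_j}\in\{x_1,\dots,x_k\}$, and $\psi$ is quantifier-free with free variables among $y_1,\dots,y_\ell$. -}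

module Defs where

open import Data.Nat using (ℕ; zero; suc; _+_; _<_)
open import Data.Fin using (Fin; zero; suc; _↑ˡ_; _↑ʳ_)
open import Data.Bool using (Bool; true)
open import Data.Product using (Σ; _×_; _,_; proj₁)
open import Data.Sum using (_⊎_)
open import Relation.Nullary using (¬_)
open import Relation.Binary.PropositionalEquality using (_≡_)
open import Data.Vec.Functional using (Vector; _∷_)

-- AP is the finite set Fin n of atomic propositions; a letter
-- of 2^AP is the characteristic function Fin n → Bool, so a ∈ t(i)
-- iff t i a ≡ true.

Trace : ℕ → Set
Trace n = ℕ → Fin n → Bool

TraceSet : ℕ → Set₁
TraceSet n = Trace n → Set

_≈ₜ_ : ∀ {n} → Trace n → Trace n → Set
t ≈ₜ t' = ∀ i a → t i a ≡ t' i a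

-- HyperLTL.  Trace variables are well-scoped de Bruijn indices:
-- Fin k = the trace variables bound by the k enclosing quantifiers
-- (zero = innermost).

data LTL (n k : ℕ) : Set where
  ap   : Fin n → Fin k → LTL n k
  neg  : LTL n k → LTL n k
  _∨ₗ_ : LTL n k → LTL n k → LTL n k
  X    : LTL n k → LTL n k
  _U_  : LTL n k → LTL n k → LTL n k

data HyperLTL (n : ℕ) : ℕ → Set where
  ∃π   : ∀ {k} → HyperLTL n (suc k) → HyperLTL n k
  ∀π   : ∀ {k} → HyperLTL n (suc k) → HyperLTL n k
  body : ∀ {k} → LTL n k → HyperLTL n k

HyperLTLSentence : ℕ → Set
HyperLTLSentence n = HyperLTL n 0

Assignment : ℕ → ℕ → Set
Assignment n k = Vector (Trace n) k

shift : ∀ {n k} → ℕ → Assignment n k → Assignment n k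
shift j Π π i = Π π (j + i)

_⊨ψ_ : ∀ {n k} → Assignment n k → LTL n k → Set
Π ⊨ψ ap a π   = Π π 0 a ≡ true
Π ⊨ψ neg ψ    = ¬ (Π ⊨ψ ψ)
Π ⊨ψ (ψ ∨ₗ χ) = (Π ⊨ψ ψ) ⊎ (Π ⊨ψ χ)
Π ⊨ψ X ψ      = shift 1 Π ⊨ψ ψ
Π ⊨ψ (ψ U χ)  = Σ ℕ λ j → (shift j Π ⊨ψ χ)
                         × (∀ j' → j' < j → shift j' Π ⊨ψ ψ)

_,_⊨ₕ_ : ∀ {n k} → TraceSet n → Assignment n k → HyperLTL n k → Set
T , Π ⊨ₕ ∃π φ   = Σ (Trace _) λ t → T t × (T , (t ∷ Π) ⊨ₕ φ)
T , Π ⊨ₕ ∀π φ   = (t : Trace _) → T t → T , (t ∷ Π) ⊨ₕ φ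
T , Π ⊨ₕ body ψ = Π ⊨ψ ψ

_⊨HyperLTL_ : ∀ {n} → TraceSet n → HyperLTLSentence n → Set
T ⊨HyperLTL φ = T , (λ ()) ⊨ₕ φ

-- FO[<,E] with equality, over the signature {<, E} ∪ {P_a : a ∈ AP}.
-- Variables are well-scoped de Bruijn indices (zero = innermost).

data FO (n m : ℕ) : Set where
  _<'_ : Fin m → Fin m → FO n m
  E    : Fin m → Fin m → FO n m
  _≐_  : Fin m → Fin m → FO n m
  P    : Fin n → Fin m → FO n m
  ¬'_  : FO n m → FO n m
  _∨'_ : FO n m → FO n m → FO n m
  _∧'_ : FO n m → FO n m → FO n m
  _⇒'_ : FO n m → FO n m → FO n m
  ∃'   : FO n (suc m) → FO n m
  ∀'   : FO n (suc m) → FO n m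

-- The structure M(T): domain T × ℕ (elements (t , i) with T t).
Dom : ℕ → Set
Dom n = Trace n × ℕ

_,_⊨FO_ : ∀ {n m} → TraceSet n → Vector (Dom n) m → FO n m → Set
T , ρ ⊨FO (x <' y) = let (t , i) = ρ x ; (t' , j) = ρ y in t ≈ₜ t' × i < j
T , ρ ⊨FO E x y    = let (t , i) = ρ x ; (t' , j) = ρ y in i ≡ j
T , ρ ⊨FO (x ≐ y)  = let (t , i) = ρ x ; (t' , j) = ρ y in t ≈ₜ t' × i ≡ j
T , ρ ⊨FO P a x    = let (t , i) = ρ x in t i a ≡ true
T , ρ ⊨FO (¬' φ)   = ¬ (T , ρ ⊨FO φ)
T , ρ ⊨FO (φ ∨' χ) = (T , ρ ⊨FO φ) ⊎ (T , ρ ⊨FO χ)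
T , ρ ⊨FO (φ ∧' χ) = (T , ρ ⊨FO φ) × (T , ρ ⊨FO χ)
T , ρ ⊨FO (φ ⇒' χ) = (T , ρ ⊨FO φ) → (T , ρ ⊨FO χ)
T , ρ ⊨FO ∃' φ     = Σ (Dom _) λ d → T (proj₁ d) × (T , (d ∷ ρ) ⊨FO φ)
T , ρ ⊨FO ∀' φ     = (d : Dom _) → T (proj₁ d) → T , (d ∷ ρ) ⊨FO φ

_⊨M_ : ∀ {n} → TraceSet n → FO n 0 → Set
T ⊨M φ = T , (λ ()) ⊨FO φ

_≤'_ : ∀ {n m} → Fin m → Fin m → FO n m
x ≤' y = (x <' y) ∨' (x ≐ y)

succ' : ∀ {n m} → Fin m → Fin m → FO n m
succ' x y = (x <' y) ∧' (¬' ∃' ((suc x <' zero) ∧' (zero <' suc y)))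

min' : ∀ {n m} → Fin m → FO n m
min' x = ¬' ∃' (succ' zero (suc x))

∃ᴹ : ∀ {n m} → FO n (suc m) → FO n m
∃ᴹ φ = ∃' (min' zero ∧' φ)

∀ᴹ : ∀ {n m} → FO n (suc m) → FO n m
∀ᴹ φ = ∀' (min' zero ⇒' φ)

∃ᴳ≥ : ∀ {n m} → Fin m → FO n (suc m) → FO n m
∃ᴳ≥ x φ = ∃' ((suc x ≤' zero) ∧' φ)

∀ᴳ≥ : ∀ {n m} → Fin m → FO n (suc m) → FO n m
∀ᴳ≥ x φ = ∀' ((suc x ≤' zero) ⇒' φ)

data QF (n m : ℕ) : Set where
  _<'_ : Fin m → Fin m → QF n m
  E    : Fin m → Fin m → QF n m
  _≐_  : Fin m → Fin m → QF n m
  P    : Fin n → Fin m → QF n m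
  ¬'_  : QF n m → QF n m
  _∨'_ : QF n m → QF n m → QF n m
  _∧'_ : QF n m → QF n m → QF n m
  _⇒'_ : QF n m → QF n m → QF n m

embedQF : ∀ {n m m'} → (Fin m → Fin m') → QF n m → FO n m'
embedQF r (x <' y) = r x <' r y
embedQF r (E x y)  = E (r x) (r y)
embedQF r (x ≐ y)  = r x ≐ r y
embedQF r (P a x)  = P a (r x)
embedQF r (¬' φ)   = ¬' embedQF r φ
embedQF r (φ ∨' χ) = embedQF r φ ∨' embedQF r χ
embedQF r (φ ∧' χ) = embedQF r φ ∧' embedQF r χ
embedQF r (φ ⇒' χ) = embedQF r φ ⇒' embedQF r χ

-- HyperFO sentences
--   Q₁ᴹ x₁ ⋯ Qₖᴹ xₖ. Q₁ᴳ y₁ ≥ x_{g₁} ⋯ Q_ℓᴳ y_ℓ ≥ x_{g_ℓ}. ψ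
-- ψ quantifier-free with free variables among the y's.

data Quant : Set where
  ∃Q ∀Q : Quant

-- guarded part: k x-variables in scope, ℓ y-variables bound so far.
-- Guards are indices into the x-variables; the body ψ only sees the
-- y-variables (Fin ℓ).
data GPart (n k : ℕ) : ℕ → Set where
  matrix : ∀ {ℓ} → QF n ℓ → GPart n k ℓ
  guard  : ∀ {ℓ} → Quant → Fin k → GPart n k (suc ℓ) → GPart n k ℓ

data MPart (n : ℕ) : ℕ → Set where
  mquant : ∀ {k} → Quant → MPart n (suc k) → MPart n k
  gpart  : ∀ {k} → GPart n k 0 → MPart n k

HyperFO : ℕ → Set
HyperFO n = MPart n 0

-- the FO[<,E] sentence denoted by a HyperFO sentence.
-- In GPart n k ℓ the FO context is ℓ + k: first the y's (innermost),
-- then the x's.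
gToFO : ∀ {n k ℓ} → GPart n k ℓ → FO n (ℓ + k)
gToFO {k = k} (matrix ψ)   = embedQF (λ y → y ↑ˡ k) ψ
gToFO {ℓ = ℓ} (guard ∃Q g φ) = ∃ᴳ≥ (ℓ ↑ʳ g) (gToFO φ)
gToFO {ℓ = ℓ} (guard ∀Q g φ) = ∀ᴳ≥ (ℓ ↑ʳ g) (gToFO φ)

mToFO : ∀ {n k} → MPart n k → FO n k
mToFO (mquant ∃Q φ) = ∃ᴹ (mToFO φ)
mToFO (mquant ∀Q φ) = ∀ᴹ (mToFO φ)
mToFO (gpart φ)     = gToFO φ

toFO : ∀ {n} → HyperFO n → FO n 0
toFO = mToFO

-- A trace variable π is represented by the point x_π = (Π π , 0) on level 0 of
-- its trace, so trace quantifiers become ∃ᴹ/∀ᴹ.  Time points are points of the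
-- trace of the innermost variable π₀, guarded by x₀: an atom a_π at time y is read
-- at the point of trace π on the level of y (∃ z ≥ x_π. E(z, y) ∧ P_a(z)), X uses
-- the successor of y on that trace and U a guarded ∀ over the points in between.
-- The resulting formula is put into prenex form: negation dualises guarded
-- quantifiers, and a disjunct can be pulled out of a guarded quantifier because,
-- classically, every guard range {y | y ≥ x} is nonempty (it contains x).

module Submission where

open import Defs
open import Axiom.ExcludedMiddle using (ExcludedMiddle)
open import Axiom.DoubleNegationElimination using (em⇒dne)
open import Data.Bool using (true)
open import Data.Empty using (⊥-elim)
open import Data.Fin using (Fin; zero; suc; _↑ˡ_; _↑ʳ_; lift)
open import Data.Nat using (ℕ; zero; suc; _+_; _<_; _≤_; z≤n; s≤s)
open import Data.Nat.Properties
  using (≤∧≮⇒≡; <-irrefl; <-≤-trans; m<1+n⇒m≤n; n<1+n; m≤m+n; +-monoʳ-<; +-cancelˡ-<;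
         m≤n⇒∃[o]m+o≡n; <⇒≤; ≤-reflexive; m≤n⇒m<n∨m≡n; +-identityʳ; +-assoc; +-comm)
open import Data.Product using (Σ; Σ-syntax; _×_; _,_; proj₁; proj₂)
open import Data.Product.Function.NonDependent.Propositional using (_×-⇔_)
open import Data.Sum using (_⊎_; inj₁; inj₂; [_,_]′)
open import Data.Sum.Function.Propositional using (_⊎-⇔_)
open import Data.Vec.Functional using (Vector; []; _∷_)
open import Function.Bundles using (_⇔_; mk⇔; module Equivalence)
open import Function.Related.Propositional using (Kind; module EquationalReasoning)
open import Function.Related.TypeIsomorphisms using (¬-cong-⇔; →-cong-⇔)
import Function.Properties.Equivalence as ⇔
open import Level using (0ℓ)
open import Relation.Nullary using (¬_; yes; no)
open import Relation.Binary.PropositionalEquality using (_≡_; refl; sym; trans; cong; subst)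

open Equivalence using (to; from)
open EquationalReasoning {k = Kind.equivalence}

private
  variable
    n k ℓ ℓ' : ℕ

-- Prenex normalisation of guarded formulas

renameQF : (Fin ℓ → Fin ℓ') → QF n ℓ → QF n ℓ'
renameQF r (x <' y) = r x <' r y
renameQF r (E x y)  = E (r x) (r y)
renameQF r (x ≐ y)  = r x ≐ r y
renameQF r (P a x)  = P a (r x)
renameQF r (¬' α)   = ¬' renameQF r α
renameQF r (α ∨' β) = renameQF r α ∨' renameQF r β
renameQF r (α ∧' β) = renameQF r α ∧' renameQF r β
renameQF r (α ⇒' β) = renameQF r α ⇒' renameQF r β

renameG : (Fin ℓ → Fin ℓ') → GPart n k ℓ → GPart n k ℓ'
renameG r (matrix α)    = matrix (renameQF r α)
renameG r (guard q g φ) = guard q g (renameG (lift 1 r) φ)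

dual : Quant → Quant
dual ∃Q = ∀Q
dual ∀Q = ∃Q

infix  7 ¬ᴳ_
infixr 5 _∨ᴹ_ _∨ᴳ_
infixr 6 _∧ᴳ_

¬ᴳ_ : GPart n k ℓ → GPart n k ℓ
¬ᴳ matrix α    = matrix (¬' α)
¬ᴳ guard q g φ = guard (dual q) g (¬ᴳ φ)

_∨ᴹ_ : QF n ℓ → GPart n k ℓ → GPart n k ℓ
α ∨ᴹ matrix β    = matrix (α ∨' β)
α ∨ᴹ guard q g φ = guard q g (renameQF suc α ∨ᴹ φ)

_∨ᴳ_ : GPart n k ℓ → GPart n k ℓ → GPart n k ℓ
matrix α    ∨ᴳ ψ = α ∨ᴹ ψ
guard q g φ ∨ᴳ ψ = guard q g (φ ∨ᴳ renameG suc ψ)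

_∧ᴳ_ : GPart n k ℓ → GPart n k ℓ → GPart n k ℓ
φ ∧ᴳ ψ = ¬ᴳ (¬ᴳ φ ∨ᴳ ¬ᴳ ψ)

_≤ᵠ_ : Fin ℓ → Fin ℓ → QF n ℓ
x ≤ᵠ y = (x <' y) ∨' (x ≐ y)

∃₀ ∀₀ : GPart n (suc k) (suc ℓ) → GPart n (suc k) ℓ
∃₀ = guard ∃Q zero
∀₀ = guard ∀Q zero

min₀ : GPart n (suc k) (suc ℓ)
min₀ = ¬ᴳ ∃₀ (matrix (zero <' suc zero))

successorOf : Fin ℓ → GPart n (suc k) (suc ℓ)
successorOf c = matrix (suc c <' zero) ∧ᴳ ¬ᴳ ∃₀ (matrix ((suc (suc c) <' zero) ∧' (zero <' suc zero)))

fromUpTo : Fin ℓ → QF n (suc (suc ℓ))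
fromUpTo c = (suc (suc c) ≤ᵠ zero) ∧' (zero <' suc zero)

-- c is the variable holding the current time point, a point of the trace of π₀.
translateLTL : Fin ℓ → LTL n (suc k) → GPart n (suc k) ℓ
translateLTL c (ap a π) = guard ∃Q π (matrix (E zero (suc c) ∧' P a zero))
translateLTL c (neg ψ)  = ¬ᴳ translateLTL c ψ
translateLTL c (ψ ∨ₗ χ) = translateLTL c ψ ∨ᴳ translateLTL c χ
translateLTL c (X ψ)    = ∃₀ (successorOf c ∧ᴳ translateLTL zero ψ)
translateLTL c (ψ U χ)  =
  ∃₀ (matrix (suc c ≤ᵠ zero) ∧ᴳ translateLTL zero χ
                              ∧ᴳ ∀₀ (matrix (¬' fromUpTo c) ∨ᴳ translateLTL zero ψ))

translateBody : LTL n (suc k) → GPart n (suc k) 0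
translateBody ψ = ∃₀ (min₀ ∧ᴳ translateLTL zero ψ)

LTL-closed-empty : ¬ LTL n 0
LTL-closed-empty (ap a ())
LTL-closed-empty (neg ψ)  = LTL-closed-empty ψ
LTL-closed-empty (ψ ∨ₗ χ) = LTL-closed-empty ψ
LTL-closed-empty (X ψ)    = LTL-closed-empty ψ
LTL-closed-empty (ψ U χ)  = LTL-closed-empty ψ

translate : HyperLTL n k → MPart n k
translate (∃π φ)              = mquant ∃Q (translate φ)
translate (∀π φ)              = mquant ∀Q (translate φ)
translate {k = zero}  (body ψ) = ⊥-elim (LTL-closed-empty ψ)
translate {k = suc k} (body ψ) = gpart (translateBody ψ)

module _ {X : Set} {D : X → Set} where

  ∃-cong : {A B : X → Set} → (∀ x → A x ⇔ B x) →
           (Σ[ x ∈ X ] D x × A x) ⇔ (Σ[ x ∈ X ] D x × B x)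
  ∃-cong A⇔B = mk⇔ (λ (x , d , a) → x , d , to (A⇔B x) a)
                   (λ (x , d , b) → x , d , from (A⇔B x) b)

  ∀-cong : {A B : X → Set} → (∀ x → A x ⇔ B x) →
           (∀ x → D x → A x) ⇔ (∀ x → D x → B x)
  ∀-cong A⇔B = mk⇔ (λ f x d → to (A⇔B x) (f x d)) (λ f x d → from (A⇔B x) (f x d))

  ¬∃⇔∀¬ : {A : X → Set} → (¬ (Σ[ x ∈ X ] D x × A x)) ⇔ (∀ x → D x → ¬ A x)
  ¬∃⇔∀¬ = mk⇔ (λ ¬∃ x d a → ¬∃ (x , d , a)) (λ ∀¬ (x , d , a) → ∀¬ x d a)

  ∃-⊎-distribˡ : {A : X → Set} {C : Set} → Σ X D →
                 (Σ[ x ∈ X ] D x × (C ⊎ A x)) ⇔ (C ⊎ Σ[ x ∈ X ] D x × A x)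
  ∃-⊎-distribˡ (x₀ , d₀) = mk⇔
    (λ { (x , d , inj₁ c) → inj₁ c ; (x , d , inj₂ a) → inj₂ (x , d , a) })
    (λ { (inj₁ c) → x₀ , d₀ , inj₁ c ; (inj₂ (x , d , a)) → x , d , inj₂ a })

  ∃-⊎-distribʳ : {A : X → Set} {C : Set} → Σ X D →
                 (Σ[ x ∈ X ] D x × (A x ⊎ C)) ⇔ ((Σ[ x ∈ X ] D x × A x) ⊎ C)
  ∃-⊎-distribʳ (x₀ , d₀) = mk⇔
    (λ { (x , d , inj₁ a) → inj₁ (x , d , a) ; (x , d , inj₂ c) → inj₂ c })
    (λ { (inj₁ (x , d , a)) → x , d , inj₁ a ; (inj₂ c) → x₀ , d₀ , inj₂ c })

module Classical (em : ExcludedMiddle 0ℓ) where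

  dne : {A : Set} → ¬ ¬ A → A
  dne = em⇒dne em

  ¬¬⊎¬⇔× : {A B : Set} → (¬ (¬ A ⊎ ¬ B)) ⇔ (A × B)
  ¬¬⊎¬⇔× = mk⇔ (λ f → dne (λ ¬a → f (inj₁ ¬a)) , dne (λ ¬b → f (inj₂ ¬b)))
                (λ (a , b) → [ (λ ¬a → ¬a a) , (λ ¬b → ¬b b) ]′)

  ¬×⊎⇔→→ : {A B C : Set} → (¬ (A × B) ⊎ C) ⇔ (A → B → C)
  ¬×⊎⇔→→ {A} {B} {C} = mk⇔ [ (λ ¬ab a b → ⊥-elim (¬ab (a , b))) , (λ c _ _ → c) ]′ decide
    where
    decide : (A → B → C) → ¬ (A × B) ⊎ C
    decide f with em {A × B}
    ... | yes (a , b) = inj₂ (f a b)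
    ... | no ¬ab      = inj₁ ¬ab

  module _ {X : Set} {D : X → Set} where

    ¬∀⇔∃¬ : {A : X → Set} → (¬ (∀ x → D x → A x)) ⇔ (Σ[ x ∈ X ] D x × ¬ A x)
    ¬∀⇔∃¬ {A} = mk⇔ (λ ¬∀ → dne (λ ¬∃ → ¬∀ (λ x d → dne (λ ¬a → ¬∃ (x , d , ¬a)))))
                   (λ (x , d , ¬a) ∀a → ¬a (∀a x d))

    ∀-⊎-distribˡ : {A : X → Set} {C : Set} →
                   (∀ x → D x → C ⊎ A x) ⇔ (C ⊎ ∀ x → D x → A x)
    ∀-⊎-distribˡ {A} {C} = mk⇔ split
      [ (λ c x d → inj₁ c) , (λ f x d → inj₂ (f x d)) ]′
      where
      split : (∀ x → D x → C ⊎ A x) → C ⊎ (∀ x → D x → A x)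
      split f with em {C}
      ... | yes c = inj₁ c
      ... | no ¬c = inj₂ λ x d → [ (λ c → ⊥-elim (¬c c)) , (λ a → a) ]′ (f x d)

    ∀-⊎-distribʳ : {A : X → Set} {C : Set} →
                   (∀ x → D x → A x ⊎ C) ⇔ ((∀ x → D x → A x) ⊎ C)
    ∀-⊎-distribʳ {A} {C} = mk⇔ split
      [ (λ f x d → inj₁ (f x d)) , (λ c x d → inj₂ c) ]′
      where
      split : (∀ x → D x → A x ⊎ C) → (∀ x → D x → A x) ⊎ C
      split f with em {C}
      ... | yes c = inj₂ c
      ... | no ¬c = inj₁ λ x d → [ (λ a → a) , (λ c → ⊥-elim (¬c c)) ]′ (f x d)

Σ-≡⇔ : {A : ℕ → Set} {m : ℕ} → (Σ[ i ∈ ℕ ] i ≡ m × A i) ⇔ A m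
Σ-≡⇔ {m = m} = mk⇔ (λ { (_ , refl , p) → p }) (λ p → m , refl , p)

¬∃<⇔≡0 : {m : ℕ} → (¬ (Σ[ i ∈ ℕ ] i < m)) ⇔ (m ≡ 0)
¬∃<⇔≡0 {zero}  = mk⇔ (λ _ → refl) (λ { _ (_ , ()) })
¬∃<⇔≡0 {suc m} = mk⇔ (λ ¬∃ → ⊥-elim (¬∃ (m , n<1+n m))) (λ ())

_⋖_ : ℕ → ℕ → Set
j ⋖ m = j < m × ¬ (Σ[ i ∈ ℕ ] j < i × i < m)

⋖⇔≡suc : {j m : ℕ} → j ⋖ m ⇔ (m ≡ suc j)
⋖⇔≡suc {j} = mk⇔
  (λ (j<m , nothing-between) → sym (≤∧≮⇒≡ j<m λ 1+j<m → nothing-between (suc j , n<1+n j , 1+j<m)))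
  (λ { refl → n<1+n j , λ (i , j<i , i<1+j) → <-irrefl refl (<-≤-trans j<i (m<1+n⇒m≤n i<1+j)) })

until-reindex : {A B : ℕ → Set} (j : ℕ) →
  (Σ[ m ∈ ℕ ] j ≤ m × A m × (∀ i → j ≤ i → i < m → B i)) ⇔
  (Σ[ i ∈ ℕ ] A (j + i) × (∀ i' → i' < i → B (j + i')))
until-reindex {A} {B} j = mk⇔ to' from'
  where
  to' : (Σ[ m ∈ ℕ ] j ≤ m × A m × (∀ i → j ≤ i → i < m → B i)) →
        (Σ[ i ∈ ℕ ] A (j + i) × (∀ i' → i' < i → B (j + i')))
  to' (m , j≤m , p , q) with m≤n⇒∃[o]m+o≡n j≤m
  ... | i , refl = i , p , λ i' i'<i → q (j + i') (m≤m+n j i') (+-monoʳ-< j i'<i)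
  from' : (Σ[ i ∈ ℕ ] A (j + i) × (∀ i' → i' < i → B (j + i'))) →
          (Σ[ m ∈ ℕ ] j ≤ m × A m × (∀ i → j ≤ i → i < m → B i))
  from' (i , p , q) = j + i , m≤m+n j i , p , earlier
    where
    earlier : ∀ i' → j ≤ i' → i' < j + i → B i'
    earlier i' j≤i' i'<j+i with m≤n⇒∃[o]m+o≡n j≤i'
    ... | d , refl = q d (+-cancelˡ-< j d i i'<j+i)

until-cong : {A A' B B' : ℕ → Set} → (∀ i → A i ⇔ A' i) → (∀ i → B i ⇔ B' i) →
  (Σ[ i ∈ ℕ ] A i × (∀ i' → i' < i → B i')) ⇔ (Σ[ i ∈ ℕ ] A' i × (∀ i' → i' < i → B' i'))
until-cong A⇔A' B⇔B' =
  mk⇔ (λ (i , a , b) → i , to (A⇔A' i) a , to (∀-cong B⇔B') b)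
      (λ (i , a , b) → i , from (A⇔A' i) a , from (∀-cong B⇔B') b)

≈ₜ-refl : {t : Trace n} → t ≈ₜ t
≈ₜ-refl i a = refl

_≈ₐ_ : Assignment n k → Assignment n k → Set
Π ≈ₐ Π' = ∀ π → Π π ≈ₜ Π' π

shift-shift : ∀ i j {m} (Π : Assignment n k) → j + i ≡ m → shift i (shift j Π) ≈ₐ shift m Π
shift-shift i j Π j+i≡m π l a = cong (λ p → Π π p a) (trans (sym (+-assoc j i l)) (cong (_+ l) j+i≡m))

⊨ψ-resp-≈ₐ : {Π Π' : Assignment n k} → Π ≈ₐ Π' → (ψ : LTL n k) → Π ⊨ψ ψ ⇔ Π' ⊨ψ ψ
⊨ψ-resp-≈ₐ Π≈Π' (ap a π) = mk⇔ (trans (sym (Π≈Π' π 0 a))) (trans (Π≈Π' π 0 a))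
⊨ψ-resp-≈ₐ Π≈Π' (neg ψ)  = ¬-cong-⇔ (⊨ψ-resp-≈ₐ Π≈Π' ψ)
⊨ψ-resp-≈ₐ Π≈Π' (ψ ∨ₗ χ) = ⊨ψ-resp-≈ₐ Π≈Π' ψ ⊎-⇔ ⊨ψ-resp-≈ₐ Π≈Π' χ
⊨ψ-resp-≈ₐ Π≈Π' (X ψ)    = ⊨ψ-resp-≈ₐ (λ π i → Π≈Π' π (1 + i)) ψ
⊨ψ-resp-≈ₐ Π≈Π' (ψ U χ)  =
  until-cong (λ j → ⊨ψ-resp-≈ₐ (λ π i → Π≈Π' π (j + i)) χ)
             (λ j → ⊨ψ-resp-≈ₐ (λ π i → Π≈Π' π (j + i)) ψ)

-- Definitionally the meaning of x ≤' y in M(T), i.e. of the guard y ≥ x.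
_≼_ : Dom n → Dom n → Set
x ≼ y = (proj₁ x ≈ₜ proj₁ y × proj₂ x < proj₂ y) ⊎ (proj₁ x ≈ₜ proj₁ y × proj₂ x ≡ proj₂ y)

start≼⇔ : {t : Trace n} {d : Dom n} → (t , 0) ≼ d ⇔ t ≈ₜ proj₁ d
start≼⇔ {d = _ , zero}  = mk⇔ [ proj₁ , proj₁ ]′ (λ t≈ → inj₂ (t≈ , refl))
start≼⇔ {d = _ , suc m} = mk⇔ [ proj₁ , proj₁ ]′ (λ t≈ → inj₁ (t≈ , s≤s z≤n))

module _ {t : Trace n} {x y : Dom n} (x∈t : t ≈ₜ proj₁ x) (y∈t : t ≈ₜ proj₁ y) where

  private
    x≈y : proj₁ x ≈ₜ proj₁ y
    x≈y i a = trans (sym (x∈t i a)) (y∈t i a)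

  <-on-trace : (proj₁ x ≈ₜ proj₁ y × proj₂ x < proj₂ y) ⇔ (proj₂ x < proj₂ y)
  <-on-trace = mk⇔ proj₂ (x≈y ,_)

  ≼-on-trace : x ≼ y ⇔ (proj₂ x ≤ proj₂ y)
  ≼-on-trace = mk⇔ [ (λ (_ , lt) → <⇒≤ lt) , (λ (_ , eq) → ≤-reflexive eq) ]′
                   (λ le → [ (λ lt → inj₁ (x≈y , lt)) , (λ eq → inj₂ (x≈y , eq)) ]′
                             (m≤n⇒m<n∨m≡n le))

infix 4 _⊨QF_

_⊨QF_ : Vector (Dom n) ℓ → QF n ℓ → Set
ys ⊨QF (x <' y) = proj₁ (ys x) ≈ₜ proj₁ (ys y) × proj₂ (ys x) < proj₂ (ys y)
ys ⊨QF E x y    = proj₂ (ys x) ≡ proj₂ (ys y)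
ys ⊨QF (x ≐ y)  = proj₁ (ys x) ≈ₜ proj₁ (ys y) × proj₂ (ys x) ≡ proj₂ (ys y)
ys ⊨QF P a x    = proj₁ (ys x) (proj₂ (ys x)) a ≡ true
ys ⊨QF (¬' α)   = ¬ ys ⊨QF α
ys ⊨QF (α ∨' β) = ys ⊨QF α ⊎ ys ⊨QF β
ys ⊨QF (α ∧' β) = ys ⊨QF α × ys ⊨QF β
ys ⊨QF (α ⇒' β) = ys ⊨QF α → ys ⊨QF β

⊨QF-rename : (r : Fin ℓ → Fin ℓ') (α : QF n ℓ) {ys : Vector (Dom n) ℓ'} {ys' : Vector (Dom n) ℓ} →
             (∀ i → ys (r i) ≡ ys' i) → ys ⊨QF renameQF r α ⇔ ys' ⊨QF α
⊨QF-rename r (x <' y) h rewrite h x | h y = ⇔.refl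
⊨QF-rename r (E x y)  h rewrite h x | h y = ⇔.refl
⊨QF-rename r (x ≐ y)  h rewrite h x | h y = ⇔.refl
⊨QF-rename r (P a x)  h rewrite h x = ⇔.refl
⊨QF-rename r (¬' α)   h = ¬-cong-⇔ (⊨QF-rename r α h)
⊨QF-rename r (α ∨' β) h = ⊨QF-rename r α h ⊎-⇔ ⊨QF-rename r β h
⊨QF-rename r (α ∧' β) h = ⊨QF-rename r α h ×-⇔ ⊨QF-rename r β h
⊨QF-rename r (α ⇒' β) h = →-cong-⇔ (⊨QF-rename r α h) (⊨QF-rename r β h)

⊨FO-embedQF : (T : TraceSet n) (r : Fin ℓ → Fin ℓ') (α : QF n ℓ)
              {ρ : Vector (Dom n) ℓ'} {ys : Vector (Dom n) ℓ} →
              (∀ i → ρ (r i) ≡ ys i) → (T , ρ ⊨FO embedQF r α) ⇔ ys ⊨QF α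
⊨FO-embedQF T r (x <' y) h rewrite h x | h y = ⇔.refl
⊨FO-embedQF T r (E x y)  h rewrite h x | h y = ⇔.refl
⊨FO-embedQF T r (x ≐ y)  h rewrite h x | h y = ⇔.refl
⊨FO-embedQF T r (P a x)  h rewrite h x = ⇔.refl
⊨FO-embedQF T r (¬' α)   h = ¬-cong-⇔ (⊨FO-embedQF T r α h)
⊨FO-embedQF T r (α ∨' β) h = ⊨FO-embedQF T r α h ⊎-⇔ ⊨FO-embedQF T r β h
⊨FO-embedQF T r (α ∧' β) h = ⊨FO-embedQF T r α h ×-⇔ ⊨FO-embedQF T r β h
⊨FO-embedQF T r (α ⇒' β) h = →-cong-⇔ (⊨FO-embedQF T r α h) (⊨FO-embedQF T r β h)

∷-lift : (r : Fin ℓ → Fin ℓ') {ys : Vector (Dom n) ℓ'} {ys' : Vector (Dom n) ℓ} (d : Dom n) →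
         (∀ i → ys (r i) ≡ ys' i) → ∀ i → (d ∷ ys) (lift 1 r i) ≡ (d ∷ ys') i
∷-lift r d h zero    = refl
∷-lift r d h (suc i) = h i

∷-↑ˡ : {ρ : Vector (Dom n) (ℓ + k)} {ys : Vector (Dom n) ℓ} (d : Dom n) →
       (∀ y → ρ (y ↑ˡ k) ≡ ys y) → ∀ y → (d ∷ ρ) (y ↑ˡ k) ≡ (d ∷ ys) y
∷-↑ˡ d h zero    = refl
∷-↑ˡ d h (suc y) = h y

module Guarded (T : TraceSet n) (xs : Vector (Dom n) k) where

  InRange : Fin k → Dom n → Set
  InRange g d = T (proj₁ d) × xs g ≼ d

  infix 4 _⊨ᴳ_

  _⊨ᴳ_ : Vector (Dom n) ℓ → GPart n k ℓ → Set
  ys ⊨ᴳ matrix α      = ys ⊨QF α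
  ys ⊨ᴳ guard ∃Q g φ = Σ[ d ∈ Dom n ] InRange g d × (d ∷ ys) ⊨ᴳ φ
  ys ⊨ᴳ guard ∀Q g φ = ∀ d → InRange g d → (d ∷ ys) ⊨ᴳ φ

  ⊨ᴳ-rename : (r : Fin ℓ → Fin ℓ') (φ : GPart n k ℓ) {ys : Vector (Dom n) ℓ'} {ys' : Vector (Dom n) ℓ} →
              (∀ i → ys (r i) ≡ ys' i) → ys ⊨ᴳ renameG r φ ⇔ ys' ⊨ᴳ φ
  ⊨ᴳ-rename r (matrix α)     h = ⊨QF-rename r α h
  ⊨ᴳ-rename r (guard ∃Q g φ) h = ∃-cong λ d → ⊨ᴳ-rename (lift 1 r) φ (∷-lift r d h)
  ⊨ᴳ-rename r (guard ∀Q g φ) h = ∀-cong λ d → ⊨ᴳ-rename (lift 1 r) φ (∷-lift r d h)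

  ⊨FO-gToFO : (φ : GPart n k ℓ) {ρ : Vector (Dom n) (ℓ + k)} {ys : Vector (Dom n) ℓ} →
              (∀ g → ρ (ℓ ↑ʳ g) ≡ xs g) → (∀ y → ρ (y ↑ˡ k) ≡ ys y) →
              (T , ρ ⊨FO gToFO φ) ⇔ ys ⊨ᴳ φ
  ⊨FO-gToFO (matrix α) hx hy = ⊨FO-embedQF T (_↑ˡ k) α hy
  ⊨FO-gToFO (guard ∃Q g φ) {ρ} {ys} hx hy =
    mk⇔ (λ (d , t , le , a) → d , (t , subst (_≼ d) (hx g) le) , to (inner d) a)
        (λ (d , (t , le) , a) → d , t , subst (_≼ d) (sym (hx g)) le , from (inner d) a)
    where
    inner : ∀ d → (T , d ∷ ρ ⊨FO gToFO φ) ⇔ d ∷ ys ⊨ᴳ φ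
    inner d = ⊨FO-gToFO φ hx (∷-↑ˡ d hy)
  ⊨FO-gToFO (guard ∀Q g φ) {ρ} {ys} hx hy =
    mk⇔ (λ f d (t , le) → to (inner d) (f d t (subst (_≼ d) (sym (hx g)) le)))
        (λ f d t le → from (inner d) (f d (t , subst (_≼ d) (hx g) le)))
    where
    inner : ∀ d → (T , d ∷ ρ ⊨FO gToFO φ) ⇔ d ∷ ys ⊨ᴳ φ
    inner d = ⊨FO-gToFO φ hx (∷-↑ˡ d hy)

  module Prenex (em : ExcludedMiddle 0ℓ) where
    open Classical em

    ⊨ᴳ-¬ᴳ : (φ : GPart n k ℓ) (ys : Vector (Dom n) ℓ) → ys ⊨ᴳ ¬ᴳ φ ⇔ (¬ ys ⊨ᴳ φ)
    ⊨ᴳ-¬ᴳ (matrix α)     ys = ⇔.refl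
    ⊨ᴳ-¬ᴳ (guard ∃Q g φ) ys = ⇔.trans (∀-cong λ d → ⊨ᴳ-¬ᴳ φ (d ∷ ys)) (⇔.sym ¬∃⇔∀¬)
    ⊨ᴳ-¬ᴳ (guard ∀Q g φ) ys = ⇔.trans (∃-cong λ d → ⊨ᴳ-¬ᴳ φ (d ∷ ys)) (⇔.sym ¬∀⇔∃¬)

  module InhabitedRanges (em : ExcludedMiddle 0ℓ) (xs∈T : ∀ g → T (proj₁ (xs g))) where
    open Classical em
    open Prenex em

    some-in-range : ∀ g → Σ (Dom n) (InRange g)
    some-in-range g = xs g , xs∈T g , inj₂ (≈ₜ-refl , refl)

    ⊨ᴳ-∨ᴹ : (α : QF n ℓ) (φ : GPart n k ℓ) (ys : Vector (Dom n) ℓ) → ys ⊨ᴳ α ∨ᴹ φ ⇔ (ys ⊨QF α ⊎ ys ⊨ᴳ φ)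
    ⊨ᴳ-∨ᴹ-under : (α : QF n ℓ) (φ : GPart n k (suc ℓ)) (ys : Vector (Dom n) ℓ) (d : Dom n) →
                  (d ∷ ys) ⊨ᴳ renameQF suc α ∨ᴹ φ ⇔ (ys ⊨QF α ⊎ (d ∷ ys) ⊨ᴳ φ)

    ⊨ᴳ-∨ᴹ α (matrix β)     ys = ⇔.refl
    ⊨ᴳ-∨ᴹ α (guard ∃Q g φ) ys = ⇔.trans (∃-cong (⊨ᴳ-∨ᴹ-under α φ ys)) (∃-⊎-distribˡ (some-in-range g))
    ⊨ᴳ-∨ᴹ α (guard ∀Q g φ) ys = ⇔.trans (∀-cong (⊨ᴳ-∨ᴹ-under α φ ys)) ∀-⊎-distribˡ

    ⊨ᴳ-∨ᴹ-under α φ ys d =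
      ⇔.trans (⊨ᴳ-∨ᴹ (renameQF suc α) φ (d ∷ ys)) (⊨QF-rename suc α (λ _ → refl) ⊎-⇔ ⇔.refl)

    ⊨ᴳ-∨ᴳ : (φ ψ : GPart n k ℓ) (ys : Vector (Dom n) ℓ) → ys ⊨ᴳ φ ∨ᴳ ψ ⇔ (ys ⊨ᴳ φ ⊎ ys ⊨ᴳ ψ)
    ⊨ᴳ-∨ᴳ-under : (φ : GPart n k (suc ℓ)) (ψ : GPart n k ℓ) (ys : Vector (Dom n) ℓ) (d : Dom n) →
                  (d ∷ ys) ⊨ᴳ φ ∨ᴳ renameG suc ψ ⇔ ((d ∷ ys) ⊨ᴳ φ ⊎ ys ⊨ᴳ ψ)

    ⊨ᴳ-∨ᴳ (matrix α)     ψ ys = ⊨ᴳ-∨ᴹ α ψ ys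
    ⊨ᴳ-∨ᴳ (guard ∃Q g φ) ψ ys = ⇔.trans (∃-cong (⊨ᴳ-∨ᴳ-under φ ψ ys)) (∃-⊎-distribʳ (some-in-range g))
    ⊨ᴳ-∨ᴳ (guard ∀Q g φ) ψ ys = ⇔.trans (∀-cong (⊨ᴳ-∨ᴳ-under φ ψ ys)) ∀-⊎-distribʳ

    ⊨ᴳ-∨ᴳ-under φ ψ ys d =
      ⇔.trans (⊨ᴳ-∨ᴳ φ (renameG suc ψ) (d ∷ ys)) (⇔.refl ⊎-⇔ ⊨ᴳ-rename suc ψ (λ _ → refl))

    ⊨ᴳ-∧ᴳ : (φ ψ : GPart n k ℓ) (ys : Vector (Dom n) ℓ) → ys ⊨ᴳ φ ∧ᴳ ψ ⇔ (ys ⊨ᴳ φ × ys ⊨ᴳ ψ)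
    ⊨ᴳ-∧ᴳ φ ψ ys =
      ⇔.trans (⊨ᴳ-¬ᴳ (¬ᴳ φ ∨ᴳ ¬ᴳ ψ) ys)
     (⇔.trans (¬-cong-⇔ (⇔.trans (⊨ᴳ-∨ᴳ (¬ᴳ φ) (¬ᴳ ψ) ys) (⊨ᴳ-¬ᴳ φ ys ⊎-⇔ ⊨ᴳ-¬ᴳ ψ ys)))
               ¬¬⊎¬⇔×)

-- Soundness of the translation

module Translation (em : ExcludedMiddle 0ℓ) (T : TraceSet n) {k : ℕ}
                   (Πx : Assignment n (suc k)) (Πx∈T : ∀ π → T (Πx π)) where

  open Classical em
  open Guarded T (λ π → Πx π , 0)
  open Prenex em
  open InhabitedRanges em Πx∈T

  ∃₀-sound : (φ : GPart n (suc k) (suc ℓ)) (ys : Vector (Dom n) ℓ) {A : ℕ → Set} →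
             (∀ t m → Πx zero ≈ₜ t → (t , m) ∷ ys ⊨ᴳ φ ⇔ A m) → ys ⊨ᴳ ∃₀ φ ⇔ Σ ℕ A
  ∃₀-sound φ ys φ⇔A =
    mk⇔ (λ ((t , m) , (_ , le) , φd) → m , to (φ⇔A t m (to start≼⇔ le)) φd)
        (λ (m , p) → (Πx zero , m) , (Πx∈T zero , from start≼⇔ ≈ₜ-refl) , from (φ⇔A _ m ≈ₜ-refl) p)

  ∀₀-sound : (φ : GPart n (suc k) (suc ℓ)) (ys : Vector (Dom n) ℓ) {A : ℕ → Set} →
             (∀ t m → Πx zero ≈ₜ t → (t , m) ∷ ys ⊨ᴳ φ ⇔ A m) → ys ⊨ᴳ ∀₀ φ ⇔ (∀ m → A m)
  ∀₀-sound φ ys φ⇔A =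
    mk⇔ (λ ∀φ m → to (φ⇔A _ m ≈ₜ-refl) (∀φ (Πx zero , m) (Πx∈T zero , from start≼⇔ ≈ₜ-refl)))
        (λ ∀A (t , m) (_ , le) → from (φ⇔A t m (to start≼⇔ le)) (∀A m))

  min₀-sound : (ys : Vector (Dom n) ℓ) (t : Trace n) (m : ℕ) → Πx zero ≈ₜ t →
               (t , m) ∷ ys ⊨ᴳ min₀ ⇔ (m ≡ 0)
  min₀-sound {ℓ = ℓ} ys t m t∈ =
    ⇔.trans (⊨ᴳ-¬ᴳ (∃₀ earlier) ((t , m) ∷ ys))
   (⇔.trans (¬-cong-⇔ (∃₀-sound earlier ((t , m) ∷ ys) λ t' m' t'∈ → <-on-trace t'∈ t∈)) ¬∃<⇔≡0)
    where
    earlier : GPart n (suc k) (suc (suc ℓ))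
    earlier = matrix (zero <' suc zero)

  successorOf-sound : (ys : Vector (Dom n) ℓ) (c : Fin ℓ) (t : Trace n) (m : ℕ) →
                      Πx zero ≈ₜ proj₁ (ys c) → Πx zero ≈ₜ t →
                      (t , m) ∷ ys ⊨ᴳ successorOf c ⇔ (m ≡ suc (proj₂ (ys c)))
  successorOf-sound {ℓ = ℓ} ys c t m c∈ t∈ =
    ⇔.trans (⊨ᴳ-∧ᴳ (matrix (suc c <' zero)) (¬ᴳ ∃₀ between) ((t , m) ∷ ys))
            (⇔.trans (<-on-trace c∈ t∈ ×-⇔ nothing-between) ⋖⇔≡suc)
    where
    between : GPart n (suc k) (suc (suc ℓ))
    between = matrix ((suc (suc c) <' zero) ∧' (zero <' suc zero))
    nothing-between : (t , m) ∷ ys ⊨ᴳ ¬ᴳ ∃₀ between ⇔ (¬ (Σ[ i ∈ ℕ ] proj₂ (ys c) < i × i < m))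
    nothing-between =
      ⇔.trans (⊨ᴳ-¬ᴳ (∃₀ between) ((t , m) ∷ ys))
              (¬-cong-⇔ (∃₀-sound between ((t , m) ∷ ys) λ t' i t'∈ →
                                   <-on-trace c∈ t'∈ ×-⇔ <-on-trace t'∈ t∈))

  translateLTL-sound : (c : Fin ℓ) (ψ : LTL n (suc k)) (ys : Vector (Dom n) ℓ) → Πx zero ≈ₜ proj₁ (ys c) →
                       ys ⊨ᴳ translateLTL c ψ ⇔ shift (proj₂ (ys c)) Πx ⊨ψ ψ
  translateLTL-sound c (ap a π) ys c∈ = mk⇔ to′ from′
    where
    j : ℕ
    j = proj₂ (ys c)
    to′ : ys ⊨ᴳ translateLTL c (ap a π) → Πx π (j + 0) a ≡ true
    to′ (d , (_ , le) , d≡j , d⊨a) rewrite +-identityʳ j =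
      trans (to start≼⇔ le j a) (subst (λ i → proj₁ d i a ≡ true) d≡j d⊨a)
    from′ : Πx π (j + 0) a ≡ true → ys ⊨ᴳ translateLTL c (ap a π)
    from′ Πx⊨a = (Πx π , j) , (Πx∈T π , from start≼⇔ ≈ₜ-refl) , refl ,
                 subst (λ i → Πx π i a ≡ true) (+-identityʳ j) Πx⊨a
  translateLTL-sound c (neg ψ) ys c∈ =
    ⇔.trans (⊨ᴳ-¬ᴳ (translateLTL c ψ) ys) (¬-cong-⇔ (translateLTL-sound c ψ ys c∈))
  translateLTL-sound c (ψ ∨ₗ χ) ys c∈ =
    ⇔.trans (⊨ᴳ-∨ᴳ (translateLTL c ψ) (translateLTL c χ) ys)
            (translateLTL-sound c ψ ys c∈ ⊎-⇔ translateLTL-sound c χ ys c∈)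
  translateLTL-sound c (X ψ) ys c∈ = begin
    ys ⊨ᴳ ∃₀ (successorOf c ∧ᴳ translateLTL zero ψ)
      ∼⟨ ∃₀-sound (successorOf c ∧ᴳ translateLTL zero ψ) ys next-at ⟩
    (Σ[ m ∈ ℕ ] m ≡ suc j × shift m Πx ⊨ψ ψ)
      ∼⟨ Σ-≡⇔ ⟩
    shift (suc j) Πx ⊨ψ ψ
      ∼⟨ ⇔.sym (⊨ψ-resp-≈ₐ (shift-shift 1 j Πx (+-comm j 1)) ψ) ⟩
    shift 1 (shift j Πx) ⊨ψ ψ ∎
    where
    j : ℕ
    j = proj₂ (ys c)
    next-at : ∀ t m → Πx zero ≈ₜ t →
              (t , m) ∷ ys ⊨ᴳ successorOf c ∧ᴳ translateLTL zero ψ ⇔ (m ≡ suc j × shift m Πx ⊨ψ ψ)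
    next-at t m t∈ =
      ⇔.trans (⊨ᴳ-∧ᴳ (successorOf c) (translateLTL zero ψ) ((t , m) ∷ ys))
              (successorOf-sound ys c t m c∈ t∈ ×-⇔ translateLTL-sound zero ψ ((t , m) ∷ ys) t∈)
  translateLTL-sound {ℓ = ℓ} c (ψ U χ) ys c∈ = begin
    ys ⊨ᴳ ∃₀ (matrix (suc c ≤ᵠ zero) ∧ᴳ χ′ ∧ᴳ ∀₀ release)
      ∼⟨ ∃₀-sound (matrix (suc c ≤ᵠ zero) ∧ᴳ χ′ ∧ᴳ ∀₀ release) ys until-at ⟩
    (Σ[ m ∈ ℕ ] j ≤ m × shift m Πx ⊨ψ χ × (∀ i → j ≤ i → i < m → shift i Πx ⊨ψ ψ))
      ∼⟨ until-reindex j ⟩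
    (Σ[ i ∈ ℕ ] shift (j + i) Πx ⊨ψ χ × (∀ i' → i' < i → shift (j + i') Πx ⊨ψ ψ))
      ∼⟨ ⇔.sym (until-cong (λ i → ⊨ψ-resp-≈ₐ (shift-shift i j Πx refl) χ)
                           (λ i → ⊨ψ-resp-≈ₐ (shift-shift i j Πx refl) ψ)) ⟩
    shift j Πx ⊨ψ (ψ U χ) ∎
    where
    j : ℕ
    j = proj₂ (ys c)
    χ′ : GPart n (suc k) (suc ℓ)
    χ′ = translateLTL zero χ
    release : GPart n (suc k) (suc (suc ℓ))
    release = matrix (¬' fromUpTo c) ∨ᴳ translateLTL zero ψ
    release-at : ∀ t m → Πx zero ≈ₜ t → ∀ t' i → Πx zero ≈ₜ t' →
      (t' , i) ∷ (t , m) ∷ ys ⊨ᴳ release ⇔ (j ≤ i → i < m → shift i Πx ⊨ψ ψ)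
    release-at t m t∈ t' i t'∈ =
      ⇔.trans (⊨ᴳ-∨ᴳ (matrix (¬' fromUpTo c)) (translateLTL zero ψ) ((t' , i) ∷ (t , m) ∷ ys))
     (⇔.trans (¬-cong-⇔ (≼-on-trace c∈ t'∈ ×-⇔ <-on-trace t'∈ t∈)
               ⊎-⇔ translateLTL-sound zero ψ ((t' , i) ∷ (t , m) ∷ ys) t'∈)
              ¬×⊎⇔→→)
    until-at : ∀ t m → Πx zero ≈ₜ t →
      (t , m) ∷ ys ⊨ᴳ matrix (suc c ≤ᵠ zero) ∧ᴳ χ′ ∧ᴳ ∀₀ release ⇔
      (j ≤ m × shift m Πx ⊨ψ χ × (∀ i → j ≤ i → i < m → shift i Πx ⊨ψ ψ))
    until-at t m t∈ =
      ⇔.trans (⊨ᴳ-∧ᴳ (matrix (suc c ≤ᵠ zero)) (χ′ ∧ᴳ ∀₀ release) ((t , m) ∷ ys))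
        (≼-on-trace c∈ t∈ ×-⇔
          ⇔.trans (⊨ᴳ-∧ᴳ χ′ (∀₀ release) ((t , m) ∷ ys))
                  (translateLTL-sound zero χ ((t , m) ∷ ys) t∈
                   ×-⇔ ∀₀-sound release ((t , m) ∷ ys) (release-at t m t∈)))

  translateBody-sound : (ψ : LTL n (suc k)) → [] ⊨ᴳ translateBody ψ ⇔ Πx ⊨ψ ψ
  translateBody-sound ψ =
    ⇔.trans (∃₀-sound (min₀ ∧ᴳ translateLTL zero ψ) [] λ t m t∈ →
               ⇔.trans (⊨ᴳ-∧ᴳ min₀ (translateLTL zero ψ) ((t , m) ∷ []))
                       (min₀-sound [] t m t∈ ×-⇔ translateLTL-sound zero ψ ((t , m) ∷ []) t∈))
            Σ-≡⇔

module _ (T : TraceSet n) where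

  min'-sound : {m : ℕ} (ρ : Vector (Dom n) m) (t : Trace n) (i : ℕ) → T t →
               (T , (t , i) ∷ ρ ⊨FO min' zero) ⇔ (i ≡ 0)
  min'-sound ρ t zero    t∈T = mk⇔ (λ _ → refl) (λ { _ (_ , _ , (_ , ()) , _) })
  min'-sound ρ t (suc i) t∈T =
    mk⇔ (λ ¬pred → ⊥-elim (¬pred ((t , i) , t∈T , (≈ₜ-refl , n<1+n i) , nothing-between))) λ ()
    where
    nothing-between : ¬ (Σ[ z ∈ Dom n ] T (proj₁ z) × (t ≈ₜ proj₁ z × i < proj₂ z)
                                                    × (proj₁ z ≈ₜ t × proj₂ z < suc i))
    nothing-between (z , _ , (_ , i<z) , (_ , z<1+i)) = proj₂ (from ⋖⇔≡suc refl) (proj₂ z , i<z , z<1+i)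

  ∷-start : {Π : Assignment n k} {ρ : Vector (Dom n) k} {t : Trace n} {i : ℕ} →
            i ≡ 0 → (∀ π → ρ π ≡ (Π π , 0)) → ∀ π → ((t , i) ∷ ρ) π ≡ ((t ∷ Π) π , 0)
  ∷-start refl ρ≡ zero    = refl
  ∷-start refl ρ≡ (suc π) = ρ≡ π

  ∷-∈T : {Π : Assignment n k} {t : Trace n} → T t → (∀ π → T (Π π)) → ∀ π → T ((t ∷ Π) π)
  ∷-∈T t∈T Π∈T zero    = t∈T
  ∷-∈T t∈T Π∈T (suc π) = Π∈T π

  translate-sound : ExcludedMiddle 0ℓ → (φ : HyperLTL n k) (Π : Assignment n k) (ρ : Vector (Dom n) k) →
                    (∀ π → T (Π π)) → (∀ π → ρ π ≡ (Π π , 0)) →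
                    (T , Π ⊨ₕ φ) ⇔ (T , ρ ⊨FO mToFO (translate φ))
  translate-sound em (∃π φ) Π ρ Π∈T ρ≡ =
    mk⇔ (λ (t , t∈T , φt) → (t , 0) , t∈T , from (min'-sound ρ t 0 t∈T) refl , to (step t 0 t∈T refl) φt)
        (λ ((t , i) , t∈T , isMin , φt) → t , t∈T , from (step t i t∈T (to (min'-sound ρ t i t∈T) isMin)) φt)
    where
    step : ∀ t i → T t → i ≡ 0 → (T , t ∷ Π ⊨ₕ φ) ⇔ (T , (t , i) ∷ ρ ⊨FO mToFO (translate φ))
    step t i t∈T i≡0 = translate-sound em φ (t ∷ Π) _ (∷-∈T t∈T Π∈T) (∷-start i≡0 ρ≡)
  translate-sound em (∀π φ) Π ρ Π∈T ρ≡ =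
    mk⇔ (λ ∀φ (t , i) t∈T isMin → to (step t i t∈T (to (min'-sound ρ t i t∈T) isMin)) (∀φ t t∈T))
        (λ ∀φ t t∈T → from (step t 0 t∈T refl) (∀φ (t , 0) t∈T (from (min'-sound ρ t 0 t∈T) refl)))
    where
    step : ∀ t i → T t → i ≡ 0 → (T , t ∷ Π ⊨ₕ φ) ⇔ (T , (t , i) ∷ ρ ⊨FO mToFO (translate φ))
    step t i t∈T i≡0 = translate-sound em φ (t ∷ Π) _ (∷-∈T t∈T Π∈T) (∷-start i≡0 ρ≡)
  translate-sound {k = zero}  em (body ψ) Π ρ Π∈T ρ≡ = ⊥-elim (LTL-closed-empty ψ)
  translate-sound {k = suc k} em (body ψ) Π ρ Π∈T ρ≡ =
    ⇔.sym (⇔.trans (Guarded.⊨FO-gToFO T (λ π → Π π , 0) (translateBody ψ) ρ≡ (λ ()))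
                   (Translation.translateBody-sound em T Π Π∈T ψ))

lemma2 : (n : ℕ) (φ : HyperLTLSentence n) →
    Σ (HyperFO n) λ φ' →
      ExcludedMiddle 0ℓ →
      (T : TraceSet n) → (T ⊨HyperLTL φ) ⇔ (T ⊨M toFO φ')
lemma2 n φ = translate φ , λ em T → translate-sound T em φ (λ ()) (λ ()) (λ ()) (λ ())
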